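{- Let $S$ be a smooth cubic surface over $K=\mathbb{F}_q$. Let $T\subseteq S(K)$ be such that $\ell(K)\subseteq T$ for every $K$-line $\ell$ contained in $S$, and such that $|T|>\frac{1}{2}|S(K)|+\frac{q+1}{2}$. Then $\mathrm{Span}(T)=S(K)$.
   Context: Secant and tangent operations on a smooth cubic surface $S$ over a field $K$: (Secant) if $P,Q\in S(K)$, $P\neq Q$, and the line through $P,Q$ is not contained in $S$, then it meets $S$ in $P+Q+R$ with $R\in S(K)$; if $R\neq P,Q$, $R$ is generated from $P,Q$. (Tangent) if $\Pi_P$ is the tangent plane to $S$ at $P\in S(K)$ and $\ell$ is a $K$-line in $\Pi_P$ through $P$ with $\ell\not\subset S$, then $\ell\cdot S=2P+R$ with $R\in S(K)$; if $R\neq P$, $R$ is generated from $P$. For $\Sigma\subseteq S(K)$, $\mathrm{Span}(\Sigma)$ is the smallest subset of $S(K)$ containing $\Sigma$ and closed under these operations. -}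

module Defs where

open import Level using (Level; _⊔_) renaming (suc to lsuc)
open import Data.Fin using (Fin; zero; suc; _≟_)
open import Data.Nat using (ℕ)
open import Data.Product using (Σ; ∃; ∃-syntax; _×_; _,_)
open import Data.List using (List)
open import Data.List.Relation.Unary.All using (All)
open import Data.List.Relation.Unary.Any using (Any)
open import Data.List.Relation.Unary.AllPairs using (AllPairs)
open import Relation.Nullary using (¬_; yes; no)
open import Algebra.Bundles using (CommutativeRing)
open import Algebra.Morphism.Structures using (IsRingHomomorphism)

record Field (c ℓ : Level) : Set (lsuc (c ⊔ ℓ)) where
  field
    commutativeRing : CommutativeRing c ℓ
  open CommutativeRing commutativeRing public
  field
    0≉1     : ¬ (0# ≈ 1#)
    inverse : ∀ x → ¬ (x ≈ 0#) → ∃[ y ] (x * y ≈ 1#)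

module Poly {c ℓ} (R : CommutativeRing c ℓ) where
  open CommutativeRing R using (Carrier; _≈_; _+_; _*_; -_; 0#; 1#)

  -- vectors in R^4 (homogeneous coordinates x₀,x₁,x₂,x₃ of P³)
  Vec4 : Set c
  Vec4 = Fin 4 → Carrier

  vec4 : Carrier → Carrier → Carrier → Carrier → Fin 4 → Carrier
  vec4 a b d e zero                   = a
  vec4 a b d e (suc zero)             = b
  vec4 a b d e (suc (suc zero))       = d
  vec4 a b d e (suc (suc (suc zero))) = e

  sum4 : (Fin 4 → Carrier) → Carrier
  sum4 f = f zero + (f (suc zero) + (f (suc (suc zero)) + f (suc (suc (suc zero)))))

  -- A cubic form F = Σ_{i,j,k} F i j k · x_i x_j x_k
  -- (every homogeneous cubic in x₀..x₃ has such a coefficient array).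
  Cubic : Set c
  Cubic = Fin 4 → Fin 4 → Fin 4 → Carrier

  eval : Cubic → Vec4 → Carrier
  eval F x = sum4 λ i → sum4 λ j → sum4 λ k → F i j k * (x i * (x j * x k))

  δ : Fin 4 → Fin 4 → Carrier
  δ i m with i ≟ m
  ... | yes _ = 1#
  ... | no  _ = 0#

  ∂ : Cubic → Fin 4 → Vec4 → Carrier
  ∂ F m x = sum4 λ i → sum4 λ j → sum4 λ k →
    F i j k * (δ i m * (x j * x k) + (δ j m * (x i * x k) + δ k m * (x i * x j)))

  NonZero : Vec4 → Set ℓ
  NonZero x = ¬ (∀ i → x i ≈ 0#)

  _∼_ : Vec4 → Vec4 → Set (c ⊔ ℓ)
  u ∼ v = ∃[ λ₀ ] (¬ (λ₀ ≈ 0#) × (∀ i → u i ≈ λ₀ * v i))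

  lin : Carrier → Vec4 → Carrier → Vec4 → Vec4
  lin a u b v i = a * u i + b * v i

  -- Restriction of F to the line {s·u + t·v}: the binary cubic form
  -- F(s u + t v) = Σ_n restrict F u v n · s^(3-n) t^n.
  -- (a₁s+b₁t)(a₂s+b₂t)(a₃s+b₃t) expanded:
  tri : Carrier → Carrier → Carrier → Carrier → Carrier → Carrier → Fin 4 → Carrier
  tri a₁ b₁ a₂ b₂ a₃ b₃ =
    vec4 (a₁ * (a₂ * a₃))
         (a₁ * (a₂ * b₃) + (a₁ * (b₂ * a₃) + b₁ * (a₂ * a₃)))
         (a₁ * (b₂ * b₃) + (b₁ * (a₂ * b₃) + b₁ * (b₂ * a₃)))
         (b₁ * (b₂ * b₃))

  restrict : Cubic → Vec4 → Vec4 → Fin 4 → Carrier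
  restrict F u v n = sum4 λ i → sum4 λ j → sum4 λ k →
    F i j k * tri (u i) (v i) (u j) (v j) (u k) (v k) n

module Surface {c ℓ} (K : Field c ℓ) where
  open Field K using (Carrier; _≈_; _+_; _*_; -_; 0#; 1#; commutativeRing)
  open Poly commutativeRing public

  -- Smoothness: no singular point over any extension field L ⊇ K
  -- (equivalently over the algebraic closure).
  Smooth : Cubic → Set (lsuc (c ⊔ ℓ))
  Smooth F =
    (L : Field c ℓ) (φ : Carrier → Field.Carrier L) →
    IsRingHomomorphism (CommutativeRing.rawRing commutativeRing)
                       (CommutativeRing.rawRing (Field.commutativeRing L)) φ →
    (x : Poly.Vec4 (Field.commutativeRing L)) →
    Poly.NonZero (Field.commutativeRing L) x →
    ¬ ( Field._≈_ L (Poly.eval (Field.commutativeRing L) (λ i j k → φ (F i j k)) x) (Field.0# L)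
      × (∀ m → Field._≈_ L (Poly.∂ (Field.commutativeRing L) (λ i j k → φ (F i j k)) m x) (Field.0# L)))

  OnS : Cubic → Vec4 → Set ℓ
  OnS F P = NonZero P × (eval F P ≈ 0#)

  LineInS : Cubic → Vec4 → Vec4 → Set ℓ
  LineInS F u v = ∀ n → restrict F u v n ≈ 0#

  OnLine : Vec4 → Vec4 → Vec4 → Set (c ⊔ ℓ)
  OnLine u v w = NonZero w × ∃[ a ] ∃[ b ] (w ∼ lin a u b v)

  InTangentPlane : Cubic → Vec4 → Vec4 → Set ℓ
  InTangentPlane F P w = sum4 (λ m → ∂ F m P * w m) ≈ 0#

  _∈ₚ_ : Vec4 → List Vec4 → Set (c ⊔ ℓ)
  w ∈ₚ T = Any (λ P → w ∼ P) T

  Distinct : List Vec4 → Set (c ⊔ ℓ)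
  Distinct T = AllPairs (λ P Q → ¬ (P ∼ Q)) T

  IsSubsetOfS : Cubic → List Vec4 → Set (c ⊔ ℓ)
  IsSubsetOfS F T = All (OnS F) T × Distinct T

  -- ℓ(K) ⊆ T for every K-line ℓ ⊂ S (a K-line is spanned by two distinct K-points)
  ContainsKLines : Cubic → List Vec4 → Set (c ⊔ ℓ)
  ContainsKLines F T =
    ∀ u v → OnS F u → OnS F v → ¬ (u ∼ v) → LineInS F u v →
    ∀ w → OnLine u v w → w ∈ₚ T

  EnumeratesS : Cubic → List Vec4 → Set (c ⊔ ℓ)
  EnumeratesS F Ls = IsSubsetOfS F Ls × (∀ P → OnS F P → P ∈ₚ Ls)

  -- Span(T): least subset of S(K) containing T and closed under the
  -- secant and tangent operations.
  -- Secant: P ≠ Q in Span, line PQ ⊄ S, and ℓ·S = P + Q + R where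
  --   R = a P + b Q, i.e. F(sP + tQ) = c·s·t·(b s − a t).
  -- Tangent: P in Span, Q ≠ P in Π_P, line PQ ⊄ S, and ℓ·S = 2P + R where
  --   R = a P + b Q, i.e. F(sP + tQ) = c·t²·(b s − a t).
  data InSpan (F : Cubic) (T : List Vec4) : Vec4 → Set (c ⊔ ℓ) where
    base    : ∀ {R} → R ∈ₚ T → InSpan F T R
    secant  : ∀ {P Q R} (a b c′ : Carrier) →
              InSpan F T P → InSpan F T Q → ¬ (P ∼ Q) →
              ¬ LineInS F P Q →
              (∀ n → restrict F P Q n ≈ vec4 0# (c′ * b) (- (c′ * a)) 0# n) →
              OnS F R → R ∼ lin a P b Q →
              ¬ (R ∼ P) → ¬ (R ∼ Q) →
              InSpan F T R
    tangent : ∀ {P Q R} (a b c′ : Carrier) →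
              InSpan F T P → NonZero Q → ¬ (Q ∼ P) →
              InTangentPlane F P Q →
              ¬ LineInS F P Q →
              (∀ n → restrict F P Q n ≈ vec4 0# 0# (c′ * b) (- (c′ * a)) n) →
              OnS F R → R ∼ lin a P b Q →
              ¬ (R ∼ P) →
              InSpan F T R

{-# OPTIONS --safe #-}
-- Fix P ∈ S(K) outside T. For Q ∈ T the line PQ is not contained in S, since T contains
-- every K-line of S, so F(sP + tQ) = st(αs + βt) with α, β not both zero. If α ≠ 0 = β the
-- line is tangent at Q and meets S in 2Q + P; if α, β ≠ 0 it meets S in P + Q + R with
-- R = -βP + αQ, and when R ∈ T the secant QR generates P. Otherwise either α = 0, i.e. Q lies
-- in the tangent plane at P, or R ∉ T. Points of the first kind lie on pairwise distinct lines
-- of the pencil through P in the tangent plane, so there are at most q + 1 of them; the points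
-- R of the second kind are pairwise distinct and lie on S outside T ∪ {P}, so
-- 1 + |T| + #R ≤ |S(K)|. Adding up gives 2|T| ≤ |S(K)| + q, contradicting the hypothesis.
module Submission where

open import Defs
open import Algebra.Bundles using (RawRing; CommutativeRing)
open import Algebra.Morphism.Construct.Identity using (isRingHomomorphism)
import Algebra.Solver.Ring
import Algebra.Solver.Ring.AlmostCommutativeRing as ACR
import Algebra.Solver.Ring.NaturalCoefficients.Default as NaturalCoefficients
open import Data.Bool using (true; false)
open import Data.Empty using (⊥; ⊥-elim)
open import Data.Fin using (Fin; zero; suc; #_; punchIn; punchOut)
import Data.Fin as Fin
open import Data.Fin.Properties using (any?; all?; ¬∀⟶∃¬; suc-injective; punchIn-punchOut)
open import Data.List using (List; []; _∷_; _++_; map; filter; length; allFin)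
open import Data.List.Membership.Propositional.Properties using (∈-allFin)
open import Data.List.Membership.Setoid.Properties using (∈-resp-≈)
open import Data.List.Properties using (length-++; length-map; length-tabulate; length-removeAt′)
open import Data.List.Relation.Unary.All as All using (All; []; _∷_)
open import Data.List.Relation.Unary.All.Properties using (¬Any⇒All¬; filter⁺; all-filter; ++⁺; map⁺)
open import Data.List.Relation.Unary.AllPairs using (AllPairs; []; _∷_)
import Data.List.Relation.Unary.AllPairs.Properties as AllPairs
open import Data.List.Relation.Unary.Any as Any using (here; there; index; _─_)
open import Data.List.Relation.Unary.Unique.Setoid using (Unique)
open import Data.Maybe using (Maybe; just; nothing)
open import Data.Nat as ℕ using (ℕ; _∸_)
import Data.Nat.Properties as ℕ
open import Data.Product using (∃-syntax; ∃₂; _×_; _,_; proj₁; proj₂)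
open import Data.Sum using (_⊎_; inj₁; inj₂; [_,_]′)
open import Function using (id; _∘_; case_of_)
open import Function.Bundles using (Bijection; Inverse; Injection)
open import Function.Properties.Bijection using (Bijection⇒Inverse)
open import Function.Properties.Inverse using (Inverse⇒Injection)
import Function.Construct.Symmetry as Symmetry
open import Level using (0ℓ; _⊔_)
open import Relation.Binary.Bundles using (Setoid)
open import Relation.Binary.Definitions using (Decidable)
open import Relation.Binary.PropositionalEquality as ≡ using (_≡_; _≢_)
open import Relation.Nullary using (¬_; Dec; yes; no; ¬?; does)
open import Relation.Nullary.Decidable using (_×-dec_; _⊎-dec_; via-injection)
import Relation.Unary as U
open import Relation.Unary.Properties using (∁?)

-- The ring solver only cancels monomials when coefficient arithmetic computes, which it does
-- not in an abstract ring; integer coefficients, as normalised differences of naturals, do.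
module IntegerCoefficientSolver {c ℓ} (R : CommutativeRing c ℓ) where
  open CommutativeRing R
  open import Algebra.Properties.Semiring.Mult semiring
    using (×-homo-+; ×1-homo-*; ×-homo-1) renaming (_×_ to _·1_)
  open import Algebra.Properties.Ring ring using (-‿distribˡ-*; -‿distribʳ-*; -0#≈0#)
  open import Algebra.Properties.AbelianGroup +-abelianGroup using (⁻¹-∙-comm; ⁻¹-anti-homo‿-)
  open import Algebra.Properties.Group +-group using (⁻¹-involutive)
  open NaturalCoefficients commutativeSemiring using (solve; _:+_; _:*_; _:=_)
  open import Relation.Binary.Reasoning.Setoid setoid

  Difference : Set
  Difference = ℕ × ℕ

  normalise : ℕ → ℕ → Difference
  normalise a b = a ∸ b , b ∸ a

  differenceRing : RawRing 0ℓ 0ℓ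
  differenceRing = record
    { Carrier = Difference
    ; _≈_     = _≡_
    ; _+_     = λ (a , b) (a′ , b′) → normalise (a ℕ.+ a′) (b ℕ.+ b′)
    ; _*_     = λ (a , b) (a′ , b′) →
                  normalise (a ℕ.* a′ ℕ.+ b ℕ.* b′) (a ℕ.* b′ ℕ.+ b ℕ.* a′)
    ; -_      = λ (a , b) → b , a
    ; 0#      = 0 , 0
    ; 1#      = 1 , 0
    }

  ⟦_⟧ : Difference → Carrier
  ⟦ a , b ⟧ = a ·1 1# - b ·1 1#

  private
    sub-cancelʳ : ∀ x y z → (x + z) - (y + z) ≈ x - y
    sub-cancelʳ x y z = begin
      (x + z) + - (y + z)      ≈⟨ +-congˡ (sym (⁻¹-∙-comm y z)) ⟩
      (x + z) + (- y + - z)    ≈⟨ solve 4 (λ x z y′ z′ → (x :+ z) :+ (y′ :+ z′) :=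
                                    (x :+ y′) :+ (z :+ z′)) refl x z (- y) (- z) ⟩
      (x + - y) + (z + - z)    ≈⟨ +-congˡ (-‿inverseʳ z) ⟩
      (x + - y) + 0#           ≈⟨ +-identityʳ _ ⟩
      x - y                    ∎

    sub-interchange : ∀ x y z w → (x + y) - (z + w) ≈ (x - z) + (y - w)
    sub-interchange x y z w = begin
      (x + y) + - (z + w)      ≈⟨ +-congˡ (sym (⁻¹-∙-comm z w)) ⟩
      (x + y) + (- z + - w)    ≈⟨ solve 4 (λ x y z′ w′ → (x :+ y) :+ (z′ :+ w′) :=
                                    (x :+ z′) :+ (y :+ w′)) refl x y (- z) (- w) ⟩
      (x - z) + (y - w)        ∎

    sub-distrib : ∀ x y z w → (x * z + y * w) - (x * w + y * z) ≈ (x - y) * (z - w)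
    sub-distrib x y z w = begin
      (x * z + y * w) + - (x * w + y * z)
        ≈⟨ +-cong (+-congˡ (sym negated)) (sym (⁻¹-∙-comm (x * w) (y * z))) ⟩
      (x * z + - y * - w) + (- (x * w) + - (y * z))
        ≈⟨ +-congˡ (+-cong (-‿distribʳ-* x w) (-‿distribˡ-* y z)) ⟩
      (x * z + - y * - w) + (x * - w + - y * z)
        ≈⟨ solve 4 (λ x y′ z w′ → (x :* z :+ y′ :* w′) :+ (x :* w′ :+ y′ :* z) :=
              (x :+ y′) :* (z :+ w′)) refl x (- y) z (- w) ⟩
      (x - y) * (z - w)        ∎
      where
      negated : - y * - w ≈ y * w
      negated = trans (sym (-‿distribˡ-* y (- w)))
                  (trans (-‿cong (sym (-‿distribʳ-* y w))) (⁻¹-involutive (y * w)))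

  ⟦⟧-cong : ∀ {a b a′ b′} → a ℕ.+ b′ ≡ a′ ℕ.+ b → ⟦ a , b ⟧ ≈ ⟦ a′ , b′ ⟧
  ⟦⟧-cong {a} {b} {a′} {b′} eq = begin
    a ·1 1# - b ·1 1#                                ≈⟨ sym (sub-cancelʳ _ _ (b′ ·1 1#)) ⟩
    (a ·1 1# + b′ ·1 1#) - (b ·1 1# + b′ ·1 1#)      ≈⟨ +-cong sums-agree (-‿cong (+-comm _ _)) ⟩
    (a′ ·1 1# + b ·1 1#) - (b′ ·1 1# + b ·1 1#)      ≈⟨ sub-cancelʳ _ _ (b ·1 1#) ⟩
    a′ ·1 1# - b′ ·1 1#                              ∎
    where
    sums-agree : a ·1 1# + b′ ·1 1# ≈ a′ ·1 1# + b ·1 1#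
    sums-agree = trans (sym (×-homo-+ 1# a b′)) (trans (reflexive (≡.cong (_·1 1#) eq)) (×-homo-+ 1# a′ b))

  ⟦normalise⟧ : ∀ a b → ⟦ normalise a b ⟧ ≈ ⟦ a , b ⟧
  ⟦normalise⟧ a b = ⟦⟧-cong {a ∸ b} {b ∸ a} (normalise-sound a b)
    where
    normalise-sound : ∀ a b → (a ∸ b) ℕ.+ b ≡ a ℕ.+ (b ∸ a)
    normalise-sound a b with ℕ.≤-total a b
    ... | inj₁ a≤b rewrite ℕ.m≤n⇒m∸n≡0 a≤b | ℕ.m+[n∸m]≡n a≤b = ≡.refl
    ... | inj₂ b≤a rewrite ℕ.m≤n⇒m∸n≡0 b≤a | ℕ.m∸n+n≡m b≤a | ℕ.+-identityʳ a = ≡.refl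

  homomorphism : differenceRing ACR.-Raw-AlmostCommutative⟶ ACR.fromCommutativeRing R
  homomorphism = record
    { ⟦_⟧    = ⟦_⟧
    ; +-homo = λ (a , b) (a′ , b′) → begin
        ⟦ normalise (a ℕ.+ a′) (b ℕ.+ b′) ⟧                    ≈⟨ ⟦normalise⟧ (a ℕ.+ a′) (b ℕ.+ b′) ⟩
        (a ℕ.+ a′) ·1 1# - (b ℕ.+ b′) ·1 1#                   ≈⟨ +-cong (×-homo-+ 1# a a′)
                                                                   (-‿cong (×-homo-+ 1# b b′)) ⟩
        (a ·1 1# + a′ ·1 1#) - (b ·1 1# + b′ ·1 1#)           ≈⟨ sub-interchange _ _ _ _ ⟩
        ⟦ a , b ⟧ + ⟦ a′ , b′ ⟧                                ∎
    ; *-homo = λ (a , b) (a′ , b′) → begin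
        ⟦ normalise (a ℕ.* a′ ℕ.+ b ℕ.* b′) (a ℕ.* b′ ℕ.+ b ℕ.* a′) ⟧
          ≈⟨ ⟦normalise⟧ (a ℕ.* a′ ℕ.+ b ℕ.* b′) (a ℕ.* b′ ℕ.+ b ℕ.* a′) ⟩
        (a ℕ.* a′ ℕ.+ b ℕ.* b′) ·1 1# - (a ℕ.* b′ ℕ.+ b ℕ.* a′) ·1 1#
          ≈⟨ +-cong (homo-*+* a a′ b b′) (-‿cong (homo-*+* a b′ b a′)) ⟩
        _                                                                 ≈⟨ sub-distrib _ _ _ _ ⟩
        ⟦ a , b ⟧ * ⟦ a′ , b′ ⟧                                            ∎
    ; -‿homo = λ (a , b) → sym (⁻¹-anti-homo‿- (a ·1 1#) (b ·1 1#))
    ; 0-homo = -‿inverseʳ 0#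
    ; 1-homo = trans (+-cong (×-homo-1 1#) -0#≈0#) (+-identityʳ 1#)
    }
    where
    homo-*+* : ∀ a a′ b b′ → (a ℕ.* a′ ℕ.+ b ℕ.* b′) ·1 1#
                             ≈ a ·1 1# * a′ ·1 1# + b ·1 1# * b′ ·1 1#
    homo-*+* a a′ b b′ = trans (×-homo-+ 1# (a ℕ.* a′) (b ℕ.* b′))
                           (+-cong (×1-homo-* a a′) (×1-homo-* b b′))

  coefficient≟ : (x y : Difference) → Maybe (⟦ x ⟧ ≈ ⟦ y ⟧)
  coefficient≟ (a , b) (a′ , b′) with a ℕ.+ b′ ℕ.≟ a′ ℕ.+ b
  ... | yes eq = just (⟦⟧-cong {a} {b} eq)
  ... | no _   = nothing

  open Algebra.Solver.Ring differenceRing (ACR.fromCommutativeRing R) homomorphism coefficient≟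
    public using (solve; _:+_; _:*_; :-_; _:=_)

module _ {a e} (S : Setoid a e) where
  open Setoid S using (_≈_; sym; trans)
  open import Data.List.Membership.Setoid S using (_∈_)

  ∈-─ : ∀ {x y ys} (x∈ys : x ∈ ys) → y ∈ ys → ¬ x ≈ y → y ∈ (ys ─ x∈ys)
  ∈-─ (here x≈z)   (here y≈z)   x≉y = ⊥-elim (x≉y (trans x≈z (sym y≈z)))
  ∈-─ (here _)     (there y∈ys) _   = y∈ys
  ∈-─ (there _)    (here y≈z)   _   = here y≈z
  ∈-─ (there x∈ys) (there y∈ys) x≉y = there (∈-─ x∈ys y∈ys x≉y)

  unique⇒length≤ : ∀ {xs ys} → Unique S xs → All (_∈ ys) xs → length xs ℕ.≤ length ys
  unique⇒length≤ []           []               = ℕ.z≤n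
  unique⇒length≤ {ys = ys} (x≉xs ∷ xs!) (x∈ys ∷ xs⊆ys) =
    ≡.subst (_ ℕ.≤_) (≡.sym (length-removeAt′ ys (index x∈ys)))
      (ℕ.s≤s (unique⇒length≤ xs!
        (All.zipWith (λ (y∈ys , x≉y) → ∈-─ x∈ys y∈ys x≉y) (xs⊆ys , x≉xs))))

module _ {a p r s} {A : Set a} {P : A → Set p} {R : A → A → Set r} {S : A → A → Set s} where

  AllPairs-map-All : (∀ {x y} → P x → P y → R x y → S x y) →
                     ∀ {xs} → All P xs → AllPairs R xs → AllPairs S xs
  AllPairs-map-All f []         []         = []
  AllPairs-map-All f (px ∷ pxs) (rx ∷ rxs) =
    All.zipWith (λ (py , rxy) → f px py rxy) (pxs , rx) ∷ AllPairs-map-All f pxs rxs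

module _ {a p} {A : Set a} {P : A → Set p} (P? : U.Decidable P) where

  length-filter+filter∁ : ∀ xs → length (filter P? xs) ℕ.+ length (filter (∁? P?) xs) ≡ length xs
  length-filter+filter∁ []       = ≡.refl
  length-filter+filter∁ (x ∷ xs) with does (P? x)
  ... | true  = ≡.cong ℕ.suc (length-filter+filter∁ xs)
  ... | false = ≡.trans (ℕ.+-suc _ _) (≡.cong ℕ.suc (length-filter+filter∁ xs))

module _ {a b p} {A : Set a} {B : Set b} {P : A → Set p} where

  All⊎⇒⊎All : ∀ {xs} → All (λ x → B ⊎ P x) xs → B ⊎ All P xs
  All⊎⇒⊎All []               = inj₂ []
  All⊎⇒⊎All (inj₁ b  ∷ _)    = inj₁ b
  All⊎⇒⊎All (inj₂ px ∷ rest) with All⊎⇒⊎All rest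
  ... | inj₁ b   = inj₁ b
  ... | inj₂ pxs = inj₂ (px ∷ pxs)

punchIn²-surjective : ∀ {n} {k m : Fin (ℕ.suc (ℕ.suc n))} (k≢m : k ≢ m) i → i ≢ k → i ≢ m →
                      ∃[ t ] punchIn k (punchIn (punchOut k≢m) t) ≡ i
punchIn²-surjective {k = k} {m} k≢m i i≢k i≢m =
  punchOut m′≢j , ≡.trans (≡.cong (punchIn k) (punchIn-punchOut m′≢j)) k+j≡i
  where
  k≢i = λ k≡i → i≢k (≡.sym k≡i)
  j = punchOut k≢i
  k+j≡i = punchIn-punchOut k≢i
  m′≢j : punchOut k≢m ≢ j
  m′≢j m′≡j = i≢m (≡.trans (≡.sym k+j≡i)
                     (≡.trans (≡.cong (punchIn k) (≡.sym m′≡j)) (punchIn-punchOut k≢m)))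

module ProjectiveSpace {c ℓ} (K : Field c ℓ) (_≟_ : Decidable (Field._≈_ K)) where
  open Field K
  open Surface K
  open import Algebra.Properties.Ring ring using (-‿distribˡ-*; -0#≈0#)
  open import Algebra.Properties.Group +-group using (⁻¹-involutive; inverseʳ-unique)
  open import Relation.Binary.Reasoning.Setoid setoid

  1≉0 : ¬ 1# ≈ 0#
  1≉0 1≈0 = 0≉1 (sym 1≈0)

  inv : ∀ x → ¬ x ≈ 0# → Carrier
  inv x x≉0 = proj₁ (inverse x x≉0)

  *-inverseʳ : ∀ x (x≉0 : ¬ x ≈ 0#) → x * inv x x≉0 ≈ 1#
  *-inverseʳ x x≉0 = proj₂ (inverse x x≉0)

  *-inverseˡ : ∀ x (x≉0 : ¬ x ≈ 0#) → inv x x≉0 * x ≈ 1#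
  *-inverseˡ x x≉0 = trans (*-comm _ x) (*-inverseʳ x x≉0)

  inv-nonzero : ∀ x (x≉0 : ¬ x ≈ 0#) → ¬ inv x x≉0 ≈ 0#
  inv-nonzero x x≉0 inv≈0 = 1≉0 (trans (sym (*-inverseʳ x x≉0)) (trans (*-congˡ inv≈0) (zeroʳ x)))

  μx≈y⇒x≈μ⁻¹y : ∀ {μ x y} (μ≉0 : ¬ μ ≈ 0#) → μ * x ≈ y → x ≈ inv μ μ≉0 * y
  μx≈y⇒x≈μ⁻¹y {μ} {x} {y} μ≉0 μx≈y = begin
    x                    ≈⟨ sym (*-identityˡ x) ⟩
    1# * x               ≈⟨ *-congʳ (sym (*-inverseˡ μ μ≉0)) ⟩
    (inv μ μ≉0 * μ) * x  ≈⟨ *-assoc _ _ _ ⟩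
    inv μ μ≉0 * (μ * x)  ≈⟨ *-congˡ μx≈y ⟩
    inv μ μ≉0 * y        ∎

  x≉0∧y≉0⇒x*y≉0 : ∀ {x y} → ¬ x ≈ 0# → ¬ y ≈ 0# → ¬ x * y ≈ 0#
  x≉0∧y≉0⇒x*y≉0 {x} {y} x≉0 y≉0 xy≈0 = y≉0 (begin
    y                    ≈⟨ μx≈y⇒x≈μ⁻¹y x≉0 xy≈0 ⟩
    inv x x≉0 * 0#       ≈⟨ zeroʳ _ ⟩
    0#                   ∎)

  x*y≈0⇒x≈0⊎y≈0 : ∀ {x y} → x * y ≈ 0# → x ≈ 0# ⊎ y ≈ 0#
  x*y≈0⇒x≈0⊎y≈0 {x} {y} xy≈0 with x ≟ 0# | y ≟ 0#
  ... | yes x≈0 | _       = inj₁ x≈0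
  ... | no _    | yes y≈0 = inj₂ y≈0
  ... | no x≉0  | no y≉0  = ⊥-elim (x≉0∧y≉0⇒x*y≉0 x≉0 y≉0 xy≈0)

  -x≉0 : ∀ {x} → ¬ x ≈ 0# → ¬ - x ≈ 0#
  -x≉0 {x} x≉0 -x≈0 = x≉0 (trans (sym (⁻¹-involutive x)) (trans (-‿cong -x≈0) -0#≈0#))

  x+y≈0⇒y≈-x : ∀ {x y} → x + y ≈ 0# → y ≈ - x
  x+y≈0⇒y≈-x = inverseʳ-unique _ _

  ∼-refl : ∀ {u} → u ∼ u
  ∼-refl = 1# , 1≉0 , λ i → sym (*-identityˡ _)

  ∼-sym : ∀ {u v} → u ∼ v → v ∼ u
  ∼-sym (μ , μ≉0 , u≈μv) = inv μ μ≉0 , inv-nonzero μ μ≉0 , λ i → μx≈y⇒x≈μ⁻¹y μ≉0 (sym (u≈μv i))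

  ∼-trans : ∀ {u v w} → u ∼ v → v ∼ w → u ∼ w
  ∼-trans (μ , μ≉0 , u≈μv) (ν , ν≉0 , v≈νw) = μ * ν , x≉0∧y≉0⇒x*y≉0 μ≉0 ν≉0 , λ i →
    trans (u≈μv i) (trans (*-congˡ (v≈νw i)) (sym (*-assoc _ _ _)))

  ℙ³ : Setoid c (c ⊔ ℓ)
  ℙ³ = record
    { Carrier       = Vec4
    ; _≈_           = _∼_
    ; isEquivalence = record { refl = ∼-refl ; sym = ∼-sym ; trans = ∼-trans }
    }

  ∼-intro : ∀ {u v μ} → NonZero u → (∀ i → u i ≈ μ * v i) → u ∼ v
  ∼-intro {μ = μ} u≉0 u≈μv with μ ≟ 0#
  ... | yes μ≈0 = ⊥-elim (u≉0 λ i → trans (u≈μv i) (trans (*-congʳ μ≈0) (zeroˡ _)))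
  ... | no μ≉0  = μ , μ≉0 , u≈μv

  scalar≈0 : ∀ {u μ} → NonZero u → (∀ i → μ * u i ≈ 0#) → μ ≈ 0#
  scalar≈0 {u} {μ} u≉0 μu≈0 with μ ≟ 0#
  ... | yes μ≈0 = μ≈0
  ... | no μ≉0  = ⊥-elim (u≉0 λ i → trans (μx≈y⇒x≈μ⁻¹y μ≉0 (μu≈0 i)) (zeroʳ _))

  independent : ∀ {P Q a b} → NonZero P → NonZero Q → ¬ P ∼ Q →
                (∀ i → lin a P b Q i ≈ 0#) → a ≈ 0# × b ≈ 0#
  independent {P} {Q} {a} {b} P≉0 Q≉0 P≁Q aP+bQ≈0 with b ≟ 0#
  ... | no b≉0 = ⊥-elim (P≁Q (∼-sym (∼-intro Q≉0 λ i → begin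
        Q i                         ≈⟨ μx≈y⇒x≈μ⁻¹y b≉0 (x+y≈0⇒y≈-x (aP+bQ≈0 i)) ⟩
        inv b b≉0 * - (a * P i)     ≈⟨ *-congˡ (-‿distribˡ-* a (P i)) ⟩
        inv b b≉0 * (- a * P i)     ≈⟨ *-assoc _ _ _ ⟨
        (inv b b≉0 * - a) * P i     ∎)))
  ... | yes b≈0 = scalar≈0 P≉0 (λ i → begin
        a * P i                     ≈⟨ +-identityʳ _ ⟨
        a * P i + 0#                ≈⟨ +-congˡ (trans (*-congʳ b≈0) (zeroˡ _)) ⟨
        a * P i + b * Q i           ≈⟨ aP+bQ≈0 i ⟩
        0#                          ∎) , b≈0

  nonzero-coordinate : ∀ {u} → NonZero u → ∃[ k ] ¬ u k ≈ 0#
  nonzero-coordinate {u} = ¬∀⟶∃¬ 4 (λ i → u i ≈ 0#) (λ i → u i ≟ 0#)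

module CubicFormProperties {c ℓ} (R : CommutativeRing c ℓ) where
  open CommutativeRing R
  open Poly R
  open IntegerCoefficientSolver R
  open import Relation.Binary.Reasoning.Setoid setoid

  dot : Vec4 → Vec4 → Carrier
  dot g w = sum4 (λ m → g m * w m)

  ∇ : Cubic → Vec4 → Vec4
  ∇ F u m = ∂ F m u

  Σ³ : (Fin 4 → Fin 4 → Fin 4 → Carrier) → Carrier
  Σ³ h = sum4 λ i → sum4 λ j → sum4 λ k → h i j k

  sum4-cong : ∀ {f g : Fin 4 → Carrier} → (∀ i → f i ≈ g i) → sum4 f ≈ sum4 g
  sum4-cong f≈g = +-cong (f≈g _) (+-cong (f≈g _) (+-cong (f≈g _) (f≈g _)))

  sum4-+ : ∀ (f g : Fin 4 → Carrier) → sum4 (λ i → f i + g i) ≈ sum4 f + sum4 g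
  sum4-+ f g = solve 8 (λ a b c d a′ b′ c′ d′ →
      (a :+ a′) :+ ((b :+ b′) :+ ((c :+ c′) :+ (d :+ d′))) :=
      (a :+ (b :+ (c :+ d))) :+ (a′ :+ (b′ :+ (c′ :+ d′)))) refl
    (f (# 0)) (f (# 1)) (f (# 2)) (f (# 3)) (g (# 0)) (g (# 1)) (g (# 2)) (g (# 3))

  sum4-* : ∀ a (f : Fin 4 → Carrier) → sum4 (λ i → a * f i) ≈ a * sum4 f
  sum4-* a f = sym (trans (distribˡ a _ _) (+-congˡ (trans (distribˡ a _ _) (+-congˡ (distribˡ a _ _)))))

  sum4-comm : ∀ (f : Fin 4 → Fin 4 → Carrier) →
              sum4 (λ i → sum4 (λ j → f i j)) ≈ sum4 (λ j → sum4 (λ i → f i j))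
  sum4-comm f = sym (trans (sum4-+ (f (# 0)) (λ j → f (# 1) j + (f (# 2) j + f (# 3) j)))
    (+-congˡ (trans (sum4-+ (f (# 1)) (λ j → f (# 2) j + f (# 3) j)) (+-congˡ (sum4-+ (f (# 2)) (f (# 3)))))))

  sum4-δ : ∀ i (x : Fin 4 → Carrier) → sum4 (λ m → δ i m * x m) ≈ x i
  sum4-δ zero x = begin
    1# * x (# 0) + (0# * x (# 1) + (0# * x (# 2) + 0# * x (# 3)))
      ≈⟨ +-cong (*-identityˡ _) (+-cong (zeroˡ _) (+-cong (zeroˡ _) (zeroˡ _))) ⟩
    x (# 0) + (0# + (0# + 0#))    ≈⟨ +-congˡ (trans (+-identityˡ _) (+-identityˡ _)) ⟩
    x (# 0) + 0#                  ≈⟨ +-identityʳ _ ⟩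
    x (# 0)                       ∎
  sum4-δ (suc zero) x = begin
    0# * x (# 0) + (1# * x (# 1) + (0# * x (# 2) + 0# * x (# 3)))
      ≈⟨ +-cong (zeroˡ _) (+-cong (*-identityˡ _) (+-cong (zeroˡ _) (zeroˡ _))) ⟩
    0# + (x (# 1) + (0# + 0#))    ≈⟨ +-identityˡ _ ⟩
    x (# 1) + (0# + 0#)           ≈⟨ +-congˡ (+-identityˡ _) ⟩
    x (# 1) + 0#                  ≈⟨ +-identityʳ _ ⟩
    x (# 1)                       ∎
  sum4-δ (suc (suc zero)) x = begin
    0# * x (# 0) + (0# * x (# 1) + (1# * x (# 2) + 0# * x (# 3)))
      ≈⟨ +-cong (zeroˡ _) (+-cong (zeroˡ _) (+-cong (*-identityˡ _) (zeroˡ _))) ⟩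
    0# + (0# + (x (# 2) + 0#))    ≈⟨ trans (+-identityˡ _) (+-identityˡ _) ⟩
    x (# 2) + 0#                  ≈⟨ +-identityʳ _ ⟩
    x (# 2)                       ∎
  sum4-δ (suc (suc (suc zero))) x = begin
    0# * x (# 0) + (0# * x (# 1) + (0# * x (# 2) + 1# * x (# 3)))
      ≈⟨ +-cong (zeroˡ _) (+-cong (zeroˡ _) (+-cong (zeroˡ _) (*-identityˡ _))) ⟩
    0# + (0# + (0# + x (# 3)))    ≈⟨ trans (+-identityˡ _) (trans (+-identityˡ _) (+-identityˡ _)) ⟩
    x (# 3)                       ∎

  sum4-single : ∀ m (f : Fin 4 → Carrier) → (∀ i → ¬ i ≡ m → f i ≈ 0#) → sum4 f ≈ f m
  sum4-single m f vanishes = trans (sum4-cong select) (sum4-δ m f)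
    where
    select : ∀ i → f i ≈ δ m i * f i
    select i with m Fin.≟ i
    ... | yes ≡.refl = sym (*-identityˡ _)
    ... | no m≢i     = trans (vanishes i (m≢i ∘ ≡.sym)) (sym (zeroˡ _))

  Σ³-cong : ∀ {f g : Fin 4 → Fin 4 → Fin 4 → Carrier} → (∀ i j k → f i j k ≈ g i j k) → Σ³ f ≈ Σ³ g
  Σ³-cong f≈g = sum4-cong λ i → sum4-cong λ j → sum4-cong λ k → f≈g i j k

  Σ³-+ : ∀ (f g : Fin 4 → Fin 4 → Fin 4 → Carrier) →
         Σ³ (λ i j k → f i j k + g i j k) ≈ Σ³ f + Σ³ g
  Σ³-+ f g = trans (sum4-cong λ i → trans (sum4-cong λ j → sum4-+ (f i j) (g i j))
                                      (sum4-+ (λ j → sum4 (f i j)) (λ j → sum4 (g i j))))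
                   (sum4-+ (λ i → sum4 λ j → sum4 (f i j)) (λ i → sum4 λ j → sum4 (g i j)))

  Σ³-* : ∀ a (f : Fin 4 → Fin 4 → Fin 4 → Carrier) → Σ³ (λ i j k → a * f i j k) ≈ a * Σ³ f
  Σ³-* a f = trans (sum4-cong λ i → trans (sum4-cong λ j → sum4-* a (f i j))
                                      (sum4-* a (λ j → sum4 (f i j))))
                   (sum4-* a (λ i → sum4 λ j → sum4 (f i j)))

  Σ³-linear : ∀ a b c d {h f₀ f₁ f₂ f₃ : Fin 4 → Fin 4 → Fin 4 → Carrier} →
    (∀ i j k → h i j k ≈ a * f₀ i j k + (b * f₁ i j k + (c * f₂ i j k + d * f₃ i j k))) →
    Σ³ h ≈ a * Σ³ f₀ + (b * Σ³ f₁ + (c * Σ³ f₂ + d * Σ³ f₃))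
  Σ³-linear a b c d {h} {f₀} {f₁} {f₂} {f₃} h≈ = begin
    Σ³ h  ≈⟨ Σ³-cong h≈ ⟩
    Σ³ (λ i j k → a * f₀ i j k + (b * f₁ i j k + (c * f₂ i j k + d * f₃ i j k)))
          ≈⟨ trans (Σ³-+ af₀ (λ i j k → bf₁ i j k + (cf₂ i j k + df₃ i j k)))
               (+-congˡ (trans (Σ³-+ bf₁ (λ i j k → cf₂ i j k + df₃ i j k)) (+-congˡ (Σ³-+ cf₂ df₃)))) ⟩
    Σ³ (λ i j k → a * f₀ i j k) + (Σ³ (λ i j k → b * f₁ i j k) +
      (Σ³ (λ i j k → c * f₂ i j k) + Σ³ (λ i j k → d * f₃ i j k)))
          ≈⟨ +-cong (Σ³-* a f₀) (+-cong (Σ³-* b f₁) (+-cong (Σ³-* c f₂) (Σ³-* d f₃))) ⟩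
    a * Σ³ f₀ + (b * Σ³ f₁ + (c * Σ³ f₂ + d * Σ³ f₃)) ∎
    where
    af₀ bf₁ cf₂ df₃ : Fin 4 → Fin 4 → Fin 4 → Carrier
    af₀ i j k = a * f₀ i j k
    bf₁ i j k = b * f₁ i j k
    cf₂ i j k = c * f₂ i j k
    df₃ i j k = d * f₃ i j k

  eval-cong : ∀ F {u v : Vec4} → (∀ i → u i ≈ v i) → eval F u ≈ eval F v
  eval-cong F {u} {v} u≈v = Σ³-cong {λ i j k → F i j k * (u i * (u j * u k))} λ i j k →
    *-congˡ (*-cong (u≈v i) (*-cong (u≈v j) (u≈v k)))

  eval-lin : ∀ F s u t v → eval F (lin s u t v) ≈
    (s * s * s) * restrict F u v (# 0) + ((s * s * t) * restrict F u v (# 1) +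
    ((s * t * t) * restrict F u v (# 2) + (t * t * t) * restrict F u v (# 3)))
  eval-lin F s u t v = Σ³-linear _ _ _ _ λ i j k →
    solve 9 (λ f s t ui vi uj vj uk vk →
      f :* ((s :* ui :+ t :* vi) :* ((s :* uj :+ t :* vj) :* (s :* uk :+ t :* vk))) :=
      (s :* s :* s) :* (f :* (ui :* (uj :* uk))) :+
      ((s :* s :* t) :* (f :* (ui :* (uj :* vk) :+ (ui :* (vj :* uk) :+ vi :* (uj :* uk)))) :+
      ((s :* t :* t) :* (f :* (ui :* (vj :* vk) :+ (vi :* (uj :* vk) :+ vi :* (vj :* uk)))) :+
      (t :* t :* t) :* (f :* (vi :* (vj :* vk)))))) refl
    (F i j k) s t (u i) (v i) (u j) (v j) (u k) (v k)

  restrict₁-flip : ∀ F u v → restrict F u v (# 1) ≈ restrict F v u (# 2)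
  restrict₁-flip F u v = Σ³-cong λ i j k →
    solve 7 (λ f ui vi uj vj uk vk →
      f :* (ui :* (uj :* vk) :+ (ui :* (vj :* uk) :+ vi :* (uj :* uk))) :=
      f :* (vi :* (uj :* uk) :+ (ui :* (vj :* uk) :+ ui :* (uj :* vk)))) refl
    (F i j k) (u i) (v i) (u j) (v j) (u k) (v k)

  dot-lin : ∀ g a u b v → dot g (lin a u b v) ≈ a * dot g u + b * dot g v
  dot-lin g a u b v = solve 14 (λ g₀ g₁ g₂ g₃ a b u₀ u₁ u₂ u₃ v₀ v₁ v₂ v₃ →
      g₀ :* (a :* u₀ :+ b :* v₀) :+ (g₁ :* (a :* u₁ :+ b :* v₁) :+
        (g₂ :* (a :* u₂ :+ b :* v₂) :+ g₃ :* (a :* u₃ :+ b :* v₃))) :=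
      a :* (g₀ :* u₀ :+ (g₁ :* u₁ :+ (g₂ :* u₂ :+ g₃ :* u₃))) :+
      b :* (g₀ :* v₀ :+ (g₁ :* v₁ :+ (g₂ :* v₂ :+ g₃ :* v₃)))) refl
    (g (# 0)) (g (# 1)) (g (# 2)) (g (# 3)) a b
    (u (# 0)) (u (# 1)) (u (# 2)) (u (# 3)) (v (# 0)) (v (# 1)) (v (# 2)) (v (# 3))

  restrict₁-polar : ∀ F u v → restrict F u v (# 1) ≈ dot (∇ F u) v
  restrict₁-polar F u v = sym (begin
    sum4 (λ m → Σ³ (λ i j k → F i j k * D i j k m) * v m)
      ≈⟨ sum4-cong (λ m → trans (*-comm _ (v m)) (trans (sym (Σ³-* (v m) (λ i j k → F i j k * D i j k m)))
           (Σ³-cong λ i j k → *-comm (v m) (F i j k * D i j k m)))) ⟩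
    sum4 (λ m → Σ³ (λ i j k → G i j k m))
      ≈⟨ sum4-comm (λ m i → sum4 λ j → sum4 λ k → G i j k m) ⟩
    sum4 (λ i → sum4 λ m → sum4 λ j → sum4 λ k → G i j k m)
      ≈⟨ sum4-cong (λ i → trans (sum4-comm (λ m j → sum4 λ k → G i j k m))
           (sum4-cong λ j → sum4-comm (λ m k → G i j k m))) ⟩
    Σ³ (λ i j k → sum4 λ m → G i j k m)
      ≈⟨ Σ³-cong contract ⟩
    restrict F u v (# 1) ∎)
    where
    D : Fin 4 → Fin 4 → Fin 4 → Fin 4 → Carrier
    D i j k m = δ i m * (u j * u k) + (δ j m * (u i * u k) + δ k m * (u i * u j))
    G : Fin 4 → Fin 4 → Fin 4 → Fin 4 → Carrier
    G i j k m = F i j k * D i j k m * v m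
    contract : ∀ i j k →
               sum4 (λ m → G i j k m) ≈ F i j k * (u i * (u j * v k) + (u i * (v j * u k) + v i * (u j * u k)))
    contract i j k = begin
      sum4 (λ m → G i j k m)
        ≈⟨ sum4-cong (λ m → solve 8 (λ f a b c di dj dk vm →
              f :* (di :* a :+ (dj :* b :+ dk :* c)) :* vm :=
              (f :* a) :* (di :* vm) :+ ((f :* b) :* (dj :* vm) :+ (f :* c) :* (dk :* vm))) refl
              (F i j k) (u j * u k) (u i * u k) (u i * u j) (δ i m) (δ j m) (δ k m) (v m)) ⟩
      sum4 (λ m → x₁ * (δ i m * v m) + (x₂ * (δ j m * v m) + x₃ * (δ k m * v m)))
        ≈⟨ trans (sum4-+ (λ m → x₁ * (δ i m * v m)) (λ m → x₂ * (δ j m * v m) + x₃ * (δ k m * v m)))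
             (+-congˡ (sum4-+ (λ m → x₂ * (δ j m * v m)) (λ m → x₃ * (δ k m * v m)))) ⟩
      sum4 (λ m → x₁ * (δ i m * v m)) + (sum4 (λ m → x₂ * (δ j m * v m)) + sum4 (λ m → x₃ * (δ k m * v m)))
        ≈⟨ +-cong (pick x₁ i) (+-cong (pick x₂ j) (pick x₃ k)) ⟩
      x₁ * v i + (x₂ * v j + x₃ * v k)
        ≈⟨ solve 7 (λ f ui vi uj vj uk vk →
              (f :* (uj :* uk)) :* vi :+ ((f :* (ui :* uk)) :* vj :+ (f :* (ui :* uj)) :* vk) :=
              f :* (ui :* (uj :* vk) :+ (ui :* (vj :* uk) :+ vi :* (uj :* uk)))) refl
              (F i j k) (u i) (v i) (u j) (v j) (u k) (v k) ⟩
      F i j k * (u i * (u j * v k) + (u i * (v j * u k) + v i * (u j * u k))) ∎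
      where
      x₁ = F i j k * (u j * u k)
      x₂ = F i j k * (u i * u k)
      x₃ = F i j k * (u i * u j)
      pick : ∀ x n → sum4 (λ m → x * (δ n m * v m)) ≈ x * v n
      pick x n = trans (sum4-* x (λ m → δ n m * v m)) (*-congˡ (sum4-δ n v))

  euler : ∀ F u → dot (∇ F u) u ≈ eval F u + (eval F u + eval F u)
  euler F u = begin
    dot (∇ F u) u          ≈⟨ sym (restrict₁-polar F u u) ⟩
    restrict F u u (# 1)   ≈⟨ Σ³-cong (λ i j k → solve 4 (λ f ui uj uk →
                                f :* (ui :* (uj :* uk) :+ (ui :* (uj :* uk) :+ ui :* (uj :* uk))) :=
                                f :* (ui :* (uj :* uk)) :+ (f :* (ui :* (uj :* uk)) :+ f :* (ui :* (uj :* uk))))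
                                refl (F i j k) (u i) (u j) (u k)) ⟩
    Σ³ (λ i j k → e i j k + (e i j k + e i j k))
                           ≈⟨ trans (Σ³-+ e (λ i j k → e i j k + e i j k)) (+-congˡ (Σ³-+ e e)) ⟩
    eval F u + (eval F u + eval F u) ∎
    where
    e : Fin 4 → Fin 4 → Fin 4 → Carrier
    e i j k = F i j k * (u i * (u j * u k))

  restrict-shift₁ : ∀ F a u b v → restrict F v (lin a u b v) (# 1) ≈
    a * restrict F u v (# 2) + (b * restrict F u v (# 3) + (b * restrict F u v (# 3) + b * restrict F u v (# 3)))
  restrict-shift₁ F a u b v = Σ³-linear a b b b λ i j k →
    solve 9 (λ f a b ui vi uj vj uk vk →
      f :* (vi :* (vj :* (a :* uk :+ b :* vk)) :+ (vi :* ((a :* uj :+ b :* vj) :* vk) :+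
        (a :* ui :+ b :* vi) :* (vj :* vk))) :=
      a :* (f :* (ui :* (vj :* vk) :+ (vi :* (uj :* vk) :+ vi :* (vj :* uk)))) :+
      (b :* (f :* (vi :* (vj :* vk))) :+ (b :* (f :* (vi :* (vj :* vk))) :+ b :* (f :* (vi :* (vj :* vk)))))) refl
    (F i j k) a b (u i) (v i) (u j) (v j) (u k) (v k)

  restrict-shift₂ : ∀ F a u b v → restrict F v (lin a u b v) (# 2) ≈
    (a * a) * restrict F u v (# 1) + ((a * b) * restrict F u v (# 2) + ((a * b) * restrict F u v (# 2) +
    (b * b) * (restrict F u v (# 3) + (restrict F u v (# 3) + restrict F u v (# 3)))))
  restrict-shift₂ F a u b v = trans
    (Σ³-linear (a * a) (a * b) (a * b) (b * b) λ i j k →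
      solve 9 (λ f a b ui vi uj vj uk vk →
        f :* (vi :* ((a :* uj :+ b :* vj) :* (a :* uk :+ b :* vk)) :+ ((a :* ui :+ b :* vi) :*
          (vj :* (a :* uk :+ b :* vk)) :+ (a :* ui :+ b :* vi) :* ((a :* uj :+ b :* vj) :* vk))) :=
        (a :* a) :* (f :* (ui :* (uj :* vk) :+ (ui :* (vj :* uk) :+ vi :* (uj :* uk)))) :+
        ((a :* b) :* (f :* (ui :* (vj :* vk) :+ (vi :* (uj :* vk) :+ vi :* (vj :* uk)))) :+
        ((a :* b) :* (f :* (ui :* (vj :* vk) :+ (vi :* (uj :* vk) :+ vi :* (vj :* uk)))) :+
        (b :* b) :* (f :* (vi :* (vj :* vk)) :+ (f :* (vi :* (vj :* vk)) :+ f :* (vi :* (vj :* vk))))))) refl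
      (F i j k) a b (u i) (v i) (u j) (v j) (u k) (v k))
    (+-congˡ (+-congˡ (+-congˡ (*-congˡ (trans (Σ³-+ t (λ i j k → t i j k + t i j k)) (+-congˡ (Σ³-+ t t)))))))
    where
    t : Fin 4 → Fin 4 → Fin 4 → Carrier
    t i j k = F i j k * tri (u i) (v i) (u j) (v j) (u k) (v k) (# 3)

module FiniteField {c ℓ} (K : Field c ℓ) {q : ℕ}
                   (enumeration : Bijection (≡.setoid (Fin q)) (Field.setoid K)) where
  open Field K hiding (zero)
  open Inverse (Bijection⇒Inverse enumeration) using (to; from; strictlyInverseˡ)

  coordinate : Injection (Field.setoid K) (≡.setoid (Fin q))
  coordinate = Inverse⇒Injection (Symmetry.inverse (Bijection⇒Inverse enumeration))

  open Injection coordinate using (injective) renaming (to to code)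

  _≟_ : Decidable _≈_
  _≟_ = via-injection coordinate Fin._≟_

  open Surface K
  open ProjectiveSpace K _≟_
  open CubicFormProperties commutativeRing
  open IntegerCoefficientSolver commutativeRing
  open import Algebra.Properties.Ring ring using (-‿distribˡ-*; -0#≈0#)
  open import Relation.Binary.Reasoning.Setoid setoid

  _∼?_ : Decidable _∼_
  u ∼? v with any? (λ μ → ¬? (to μ ≟ 0#) ×-dec all? (λ i → u i ≟ (to μ * v i)))
  ... | yes (μ , μ≉0 , u≈μv) = yes (to μ , μ≉0 , u≈μv)
  ... | no ∄μ                = no λ (μ , μ≉0 , u≈μv) → ∄μ (from μ ,
        (λ μ≈0 → μ≉0 (trans (sym (strictlyInverseˡ μ)) μ≈0)) ,
        (λ i → trans (u≈μv i) (*-congʳ (sym (strictlyInverseˡ μ)))))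

  _∈ₚ?_ : ∀ w T → Dec (w ∈ₚ T)
  w ∈ₚ? T = Any.any? (w ∼?_) T

  lin∼right⇒left≈0 : ∀ {P Q a b} → NonZero P → NonZero Q → ¬ P ∼ Q → lin a P b Q ∼ Q → a ≈ 0#
  lin∼right⇒left≈0 {P} {Q} {a} {b} P≉0 Q≉0 P≁Q (μ , _ , aP+bQ≈μQ) =
    proj₁ (independent {b = b - μ} P≉0 Q≉0 P≁Q λ i → begin
      a * P i + (b - μ) * Q i         ≈⟨ solve 5 (λ a b μ p x → a :* p :+ (b :+ :- μ) :* x :=
                                           (a :* p :+ b :* x) :+ :- (μ :* x)) refl a b μ (P i) (Q i) ⟩
      (a * P i + b * Q i) - μ * Q i   ≈⟨ +-congʳ (aP+bQ≈μQ i) ⟩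
      μ * Q i - μ * Q i               ≈⟨ -‿inverseʳ _ ⟩
      0#                              ∎)

  lin∼left⇒right≈0 : ∀ {P Q a b} → NonZero P → NonZero Q → ¬ P ∼ Q → lin a P b Q ∼ P → b ≈ 0#
  lin∼left⇒right≈0 {P} {Q} {a} {b} P≉0 Q≉0 P≁Q (μ , _ , aP+bQ≈μP) =
    proj₂ (independent {a = a - μ} P≉0 Q≉0 P≁Q λ i → begin
      (a - μ) * P i + b * Q i         ≈⟨ solve 5 (λ a b μ p x → (a :+ :- μ) :* p :+ b :* x :=
                                           (a :* p :+ b :* x) :+ :- (μ :* p)) refl a b μ (P i) (Q i) ⟩
      (a * P i + b * Q i) - μ * P i   ≈⟨ +-congʳ (aP+bQ≈μP i) ⟩
      μ * P i - μ * P i               ≈⟨ -‿inverseʳ _ ⟩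
      0#                              ∎)

  ℙ¹-index : Carrier → Carrier → Fin (ℕ.suc q)
  ℙ¹-index x y with x ≟ 0#
  ... | yes _   = zero
  ... | no x≉0  = suc (code (y * inv x x≉0))

  ℙ¹-index-injective : ∀ {x₁ y₁ x₂ y₂} → ¬ (x₂ ≈ 0# × y₂ ≈ 0#) → ℙ¹-index x₁ y₁ ≡ ℙ¹-index x₂ y₂ →
                       ∃[ λ₀ ] (x₁ ≈ λ₀ * x₂ × y₁ ≈ λ₀ * y₂)
  ℙ¹-index-injective {x₁} {y₁} {x₂} {y₂} ¬x₂≈0∧y₂≈0 same with x₁ ≟ 0# | x₂ ≟ 0#
  ... | yes x₁≈0 | yes x₂≈0 = λ₀ , trans x₁≈0 (sym (trans (*-congˡ x₂≈0) (zeroʳ _))) , (begin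
        y₁                         ≈⟨ *-identityʳ _ ⟨
        y₁ * 1#                    ≈⟨ *-congˡ (*-inverseˡ y₂ y₂≉0) ⟨
        y₁ * (inv y₂ y₂≉0 * y₂)    ≈⟨ *-assoc _ _ _ ⟨
        λ₀ * y₂                    ∎)
    where
    y₂≉0 : ¬ y₂ ≈ 0#
    y₂≉0 y₂≈0 = ¬x₂≈0∧y₂≈0 (x₂≈0 , y₂≈0)
    λ₀ = y₁ * inv y₂ y₂≉0
  ... | no x₁≉0 | no x₂≉0 = λ₀ , (begin
        x₁                         ≈⟨ *-identityʳ _ ⟨
        x₁ * 1#                    ≈⟨ *-congˡ (*-inverseˡ x₂ x₂≉0) ⟨
        x₁ * (inv x₂ x₂≉0 * x₂)    ≈⟨ *-assoc _ _ _ ⟨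
        λ₀ * x₂                    ∎) , (begin
        y₁                                   ≈⟨ *-identityʳ _ ⟨
        y₁ * 1#                              ≈⟨ *-congˡ (*-inverseʳ x₁ x₁≉0) ⟨
        y₁ * (x₁ * inv x₁ x₁≉0)              ≈⟨ solve 3 (λ y x i → y :* (x :* i) := x :* (y :* i)) refl _ _ _ ⟩
        x₁ * (y₁ * inv x₁ x₁≉0)              ≈⟨ *-congˡ (injective (suc-injective same)) ⟩
        x₁ * (y₂ * inv x₂ x₂≉0)              ≈⟨ solve 3 (λ x y i → x :* (y :* i) := (x :* i) :* y) refl _ _ _ ⟩
        λ₀ * y₂                              ∎)
    where
    λ₀ = x₁ * inv x₂ x₂≉0

  module Pencil {g P : Vec4} (P≉0 : NonZero P) (g≉0 : NonZero g) (g·P≈0 : dot g P ≈ 0#) where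

    k : Fin 4
    k = proj₁ (nonzero-coordinate P≉0)

    Pk≉0 : ¬ P k ≈ 0#
    Pk≉0 = proj₂ (nonzero-coordinate P≉0)

    -- Since g · P = 0 and P k ≠ 0, the covector g cannot be supported on k alone.
    second-coordinate : ∃[ m ] ¬ (m ≡ k ⊎ g m ≈ 0#)
    second-coordinate = ¬∀⟶∃¬ 4 _ (λ j → j Fin.≟ k ⊎-dec g j ≟ 0#) λ supported → g≉0 λ j →
      [ (λ { ≡.refl → gk≈0 supported }) , (λ gj≈0 → gj≈0) ]′ (supported j)
      where
      gk≈0 : (∀ j → j ≡ k ⊎ g j ≈ 0#) → g k ≈ 0#
      gk≈0 supported = [ (λ gk≈0 → gk≈0) , (λ Pk≈0 → ⊥-elim (Pk≉0 Pk≈0)) ]′ (x*y≈0⇒x≈0⊎y≈0 (begin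
        g k * P k     ≈⟨ sum4-single k (λ j → g j * P j) (λ j j≢k →
                           [ (λ j≡k → ⊥-elim (j≢k j≡k)) , (λ gj≈0 → trans (*-congʳ gj≈0) (zeroˡ _)) ]′ (supported j)) ⟨
        dot g P       ≈⟨ g·P≈0 ⟩
        0#            ∎))

    m : Fin 4
    m = proj₁ second-coordinate

    k≢m : k ≢ m
    k≢m k≡m = proj₂ second-coordinate (inj₁ (≡.sym k≡m))

    gm≉0 : ¬ g m ≈ 0#
    gm≉0 gm≈0 = proj₂ second-coordinate (inj₂ gm≈0)

    other : Fin 2 → Fin 4
    other t = punchIn k (punchIn (punchOut k≢m) t)

    vanish-off-m : ∀ {z : Vec4} → z k ≈ 0# → (∀ t → z (other t) ≈ 0#) → ∀ i → i ≢ m → z i ≈ 0#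
    vanish-off-m zk≈0 z-other≈0 i i≢m with i Fin.≟ k
    ... | yes ≡.refl = zk≈0
    ... | no i≢k with punchIn²-surjective k≢m i i≢k i≢m
    ...   | t , ≡.refl = z-other≈0 t

    vanish : ∀ {z : Vec4} → z k ≈ 0# → (∀ t → z (other t) ≈ 0#) → dot g z ≈ 0# → ∀ i → z i ≈ 0#
    vanish {z} zk≈0 z-other≈0 g·z≈0 i with i Fin.≟ m
    ... | no i≢m     = vanish-off-m zk≈0 z-other≈0 i i≢m
    ... | yes ≡.refl = [ (λ gm≈0 → ⊥-elim (gm≉0 gm≈0)) , id ]′ (x*y≈0⇒x≈0⊎y≈0 (begin
          g i * z i     ≈⟨ sum4-single i (λ j → g j * z j) (λ j j≢i →
                             trans (*-congˡ (vanish-off-m zk≈0 z-other≈0 j j≢i)) (zeroʳ _)) ⟨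
          dot g z       ≈⟨ g·z≈0 ⟩
          0#            ∎))

    -- P k · w - w k · P lies on the line Pw and has k-th coordinate 0; on the plane g = 0 it
    -- is therefore determined up to a scalar by its two coordinates at `other`, which `pencil`
    -- reads off as a point of ℙ¹(K).
    project : Vec4 → Vec4
    project w = lin (P k) w (- w k) P

    project-k : ∀ w → project w k ≈ 0#
    project-k w = trans (solve 2 (λ p x → p :* x :+ (:- x) :* p := p :* x :+ :- (p :* x)) refl (P k) (w k))
                        (-‿inverseʳ _)

    project-in-plane : ∀ w → dot g w ≈ 0# → dot g (project w) ≈ 0#
    project-in-plane w g·w≈0 = begin
      dot g (project w)                      ≈⟨ dot-lin g (P k) w (- w k) P ⟩
      P k * dot g w + - w k * dot g P        ≈⟨ +-cong (*-congˡ g·w≈0) (*-congˡ g·P≈0) ⟩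
      P k * 0# + - w k * 0#                  ≈⟨ +-cong (zeroʳ _) (zeroʳ _) ⟩
      0# + 0#                                ≈⟨ +-identityʳ _ ⟩
      0#                                     ∎

    decompose : ∀ w i → P k * w i ≈ w k * P i + project w i
    decompose w i = solve 4 (λ p x y z → p :* x := y :* z :+ (p :* x :+ (:- y) :* z)) refl (P k) (w i) (w k) (P i)

    pencil : Vec4 → Fin (ℕ.suc q)
    pencil w = ℙ¹-index (project w (other zero)) (project w (other (suc zero)))

    pencil-defined : ∀ {w} → NonZero w → ¬ P ∼ w → dot g w ≈ 0# →
                     ¬ (project w (other zero) ≈ 0# × project w (other (suc zero)) ≈ 0#)
    pencil-defined {w} w≉0 P≁w g·w≈0 (p₀≈0 , p₁≈0) = P≁w (∼-sym (∼-intro w≉0 λ i → begin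
      w i                                       ≈⟨ μx≈y⇒x≈μ⁻¹y Pk≉0 (decompose w i) ⟩
      inv (P k) Pk≉0 * (w k * P i + project w i) ≈⟨ *-congˡ (+-congˡ (project≈0 i)) ⟩
      inv (P k) Pk≉0 * (w k * P i + 0#)          ≈⟨ *-congˡ (+-identityʳ _) ⟩
      inv (P k) Pk≉0 * (w k * P i)               ≈⟨ *-assoc _ _ _ ⟨
      (inv (P k) Pk≉0 * w k) * P i               ∎))
      where
      project≈0 : ∀ i → project w i ≈ 0#
      project≈0 = vanish (project-k w) (λ { zero → p₀≈0 ; (suc zero) → p₁≈0 }) (project-in-plane w g·w≈0)

    pencil-injective : ∀ {w w′} → NonZero w → ¬ P ∼ w → dot g w ≈ 0# → dot g w′ ≈ 0# →
                       pencil w′ ≡ pencil w → ∃₂ λ a b → ∀ i → w′ i ≈ a * P i + b * w i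
    pencil-injective {w} {w′} w≉0 P≁w g·w≈0 g·w′≈0 same =
      inv (P k) Pk≉0 * (w′ k - λ₀ * w k) , λ₀ , λ i → begin
        w′ i
          ≈⟨ μx≈y⇒x≈μ⁻¹y Pk≉0 (decompose w′ i) ⟩
        inv (P k) Pk≉0 * (w′ k * P i + project w′ i)
          ≈⟨ *-congˡ (+-congˡ (proportional i)) ⟩
        inv (P k) Pk≉0 * (w′ k * P i + λ₀ * (P k * w i + - w k * P i))
          ≈⟨ solve 7 (λ ι p λ₀ x y′ y pk → ι :* (y′ :* p :+ λ₀ :* (pk :* x :+ (:- y) :* p)) :=
               (ι :* (y′ :+ :- (λ₀ :* y))) :* p :+ (ι :* pk) :* (λ₀ :* x)) refl
               (inv (P k) Pk≉0) (P i) λ₀ (w i) (w′ k) (w k) (P k) ⟩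
        (inv (P k) Pk≉0 * (w′ k - λ₀ * w k)) * P i + (inv (P k) Pk≉0 * P k) * (λ₀ * w i)
          ≈⟨ +-congˡ (trans (*-congʳ (*-inverseˡ (P k) Pk≉0)) (*-identityˡ _)) ⟩
        (inv (P k) Pk≉0 * (w′ k - λ₀ * w k)) * P i + λ₀ * w i ∎
      where
      ratio = ℙ¹-index-injective (pencil-defined w≉0 P≁w g·w≈0) same
      λ₀ = proj₁ ratio
      difference : Vec4
      difference = lin 1# (project w′) (- λ₀) (project w)
      cancels : ∀ {x y} → x ≈ λ₀ * y → 1# * x + - λ₀ * y ≈ 0#
      cancels {x} {y} x≈λy = begin
        1# * x + - λ₀ * y            ≈⟨ +-cong (trans (*-identityˡ x) x≈λy) (sym (-‿distribˡ-* λ₀ y)) ⟩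
        λ₀ * y + - (λ₀ * y)          ≈⟨ -‿inverseʳ _ ⟩
        0#                           ∎
      difference≈0 : ∀ i → difference i ≈ 0#
      difference≈0 = vanish
        (cancels (trans (project-k w′) (sym (trans (*-congˡ (project-k w)) (zeroʳ _)))))
        (λ { zero → cancels (proj₁ (proj₂ ratio)) ; (suc zero) → cancels (proj₂ (proj₂ ratio)) })
        (begin
          dot g difference                                     ≈⟨ dot-lin g 1# (project w′) (- λ₀) (project w) ⟩
          1# * dot g (project w′) + - λ₀ * dot g (project w)   ≈⟨ +-cong (*-congˡ (project-in-plane w′ g·w′≈0))
                                                                         (*-congˡ (project-in-plane w g·w≈0)) ⟩
          1# * 0# + - λ₀ * 0#                                  ≈⟨ +-cong (zeroʳ _) (zeroʳ _) ⟩
          0# + 0#                                              ≈⟨ +-identityʳ _ ⟩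
          0#                                                   ∎)
      proportional : ∀ i → project w′ i ≈ λ₀ * project w i
      proportional i = begin
        project w′ i
          ≈⟨ solve 3 (λ x l y → x := (x :+ (:- l) :* y) :+ l :* y) refl (project w′ i) λ₀ (project w i) ⟩
        (project w′ i + - λ₀ * project w i) + λ₀ * project w i
          ≈⟨ +-congʳ (trans (+-congʳ (sym (*-identityˡ _))) (difference≈0 i)) ⟩
        0# + λ₀ * project w i
          ≈⟨ +-identityˡ _ ⟩
        λ₀ * project w i ∎

  module OutsidePoint (F : Cubic) (T : List Vec4) (T-lines : ContainsKLines F T)
                      {P : Vec4} (P∈S : OnS F P) (P∉T : ¬ P ∈ₚ T) where

    α β : Vec4 → Carrier
    α Q = restrict F P Q (# 1)
    β Q = restrict F P Q (# 2)

    -- F(sP + tQ) = st(αs + βt) for Q ∈ S (eval-PQ), whose third root is (s : t) = (-β : α).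
    third : Vec4 → Vec4
    third Q = lin (- β Q) P (α Q) Q

    P≉0 : NonZero P
    P≉0 = proj₁ P∈S

    ≁-of-∈T : ∀ {Q} → Q ∈ₚ T → ¬ P ∼ Q
    ≁-of-∈T Q∈T P∼Q = P∉T (∈-resp-≈ ℙ³ (∼-sym P∼Q) Q∈T)

    PQ⊄S : ∀ {Q} → OnS F Q → ¬ P ∼ Q → ¬ LineInS F P Q
    PQ⊄S {Q} Q∈S P≁Q PQ⊆S = P∉T (T-lines P Q P∈S Q∈S P≁Q PQ⊆S P (P≉0 , 1# , 0# , P≈1P+0Q))
      where
      P≈1P+0Q : P ∼ lin 1# P 0# Q
      P≈1P+0Q = ∼-intro P≉0 λ i → sym (begin
        1# * (1# * P i + 0# * Q i)  ≈⟨ *-identityˡ _ ⟩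
        1# * P i + 0# * Q i         ≈⟨ +-cong (*-identityˡ _) (zeroˡ _) ⟩
        P i + 0#                    ≈⟨ +-identityʳ _ ⟩
        P i                         ∎)

    ¬α≈0∧β≈0 : ∀ {Q} → OnS F Q → ¬ P ∼ Q → α Q ≈ 0# → ¬ β Q ≈ 0#
    ¬α≈0∧β≈0 {Q} Q∈S P≁Q α≈0 β≈0 = PQ⊄S Q∈S P≁Q λ
      { zero                   → proj₂ P∈S
      ; (suc zero)             → α≈0
      ; (suc (suc zero))       → β≈0
      ; (suc (suc (suc zero))) → proj₂ Q∈S
      }

    eval-PQ : ∀ {Q} → OnS F Q → ∀ x y → eval F (lin x P y Q) ≈ (x * x * y) * α Q + (x * y * y) * β Q
    eval-PQ {Q} Q∈S x y = begin
      eval F (lin x P y Q)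
        ≈⟨ eval-lin F x P y Q ⟩
      (x * x * x) * eval F P + ((x * x * y) * α Q + ((x * y * y) * β Q + (y * y * y) * eval F Q))
        ≈⟨ +-cong (*-congˡ (proj₂ P∈S)) (+-congˡ (+-congˡ (*-congˡ (proj₂ Q∈S)))) ⟩
      (x * x * x) * 0# + ((x * x * y) * α Q + ((x * y * y) * β Q + (y * y * y) * 0#))
        ≈⟨ +-cong (zeroʳ _) (+-congˡ (trans (+-congˡ (zeroʳ _)) (+-identityʳ _))) ⟩
      0# + ((x * x * y) * α Q + (x * y * y) * β Q)
        ≈⟨ +-identityˡ _ ⟩
      (x * x * y) * α Q + (x * y * y) * β Q ∎

    third∈S : ∀ {Q} → OnS F Q → ¬ P ∼ Q → ¬ α Q ≈ 0# → OnS F (third Q)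
    third∈S {Q} Q∈S P≁Q α≉0 = third≉0 , (begin
      eval F (third Q)                                      ≈⟨ eval-PQ Q∈S (- β Q) (α Q) ⟩
      (- β Q * - β Q * α Q) * α Q + (- β Q * α Q * α Q) * β Q
        ≈⟨ solve 2 (λ a b → ((:- b) :* (:- b) :* a) :* a :+ ((:- b) :* a :* a) :* b :=
             (b :* b :* a :* a) :+ :- (b :* b :* a :* a)) refl (α Q) (β Q) ⟩
      (β Q * β Q * α Q * α Q) - (β Q * β Q * α Q * α Q)   ≈⟨ -‿inverseʳ _ ⟩
      0#                                                    ∎)
      where
      third≉0 : NonZero (third Q)
      third≉0 third≈0 = α≉0 (proj₂ (independent P≉0 (proj₁ Q∈S) P≁Q third≈0))

    third≁P : ∀ {Q} → OnS F Q → ¬ P ∼ Q → ¬ α Q ≈ 0# → ¬ third Q ∼ P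
    third≁P Q∈S P≁Q α≉0 third∼P = α≉0 (lin∼left⇒right≈0 P≉0 (proj₁ Q∈S) P≁Q third∼P)

    third≁Q : ∀ {Q} → OnS F Q → ¬ P ∼ Q → ¬ β Q ≈ 0# → ¬ third Q ∼ Q
    third≁Q Q∈S P≁Q β≉0 third∼Q = -x≉0 β≉0 (lin∼right⇒left≈0 P≉0 (proj₁ Q∈S) P≁Q third∼Q)

    P-by-tangent : ∀ {Q} → Q ∈ₚ T → OnS F Q → ¬ P ∼ Q → ¬ α Q ≈ 0# → β Q ≈ 0# → InSpan F T P
    P-by-tangent {Q} Q∈T Q∈S P≁Q α≉0 β≈0 =
      tangent 0# 1# (α Q) (base Q∈T) P≉0 P≁Q P∈ΠQ QP⊄S coefficients P∈S P∼0Q+1P P≁Q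
      where
      QP₁≈0 : restrict F Q P (# 1) ≈ 0#
      QP₁≈0 = trans (restrict₁-flip F Q P) β≈0
      QP₂≈α : restrict F Q P (# 2) ≈ α Q
      QP₂≈α = sym (restrict₁-flip F P Q)
      P∈ΠQ : InTangentPlane F Q P
      P∈ΠQ = trans (sym (restrict₁-polar F Q P)) QP₁≈0
      QP⊄S : ¬ LineInS F Q P
      QP⊄S QP⊆S = α≉0 (trans (sym QP₂≈α) (QP⊆S (# 2)))
      coefficients : ∀ n → restrict F Q P n ≈ vec4 0# 0# (α Q * 1#) (- (α Q * 0#)) n
      coefficients zero                   = proj₂ Q∈S
      coefficients (suc zero)             = QP₁≈0
      coefficients (suc (suc zero))       = trans QP₂≈α (sym (*-identityʳ _))
      coefficients (suc (suc (suc zero))) = trans (proj₂ P∈S) (sym (trans (-‿cong (zeroʳ _)) -0#≈0#))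
      P∼0Q+1P : P ∼ lin 0# Q 1# P
      P∼0Q+1P = ∼-intro P≉0 λ i → sym (begin
        1# * (0# * Q i + 1# * P i)  ≈⟨ *-identityˡ _ ⟩
        0# * Q i + 1# * P i         ≈⟨ +-cong (zeroˡ _) (*-identityˡ _) ⟩
        0# + P i                    ≈⟨ +-identityˡ _ ⟩
        P i                         ∎)

    P-by-secant : ∀ {Q} → Q ∈ₚ T → OnS F Q → ¬ P ∼ Q → ¬ α Q ≈ 0# → ¬ β Q ≈ 0# →
                  third Q ∈ₚ T → InSpan F T P
    P-by-secant {Q} Q∈T Q∈S P≁Q α≉0 β≉0 R∈T =
      secant (- α Q) 1# (- (β Q * β Q)) (base Q∈T) (base R∈T) Q≁R QR⊄S coefficients P∈S
             P∼-αQ+R P≁Q (λ P∼R → third≁P Q∈S P≁Q α≉0 (∼-sym P∼R))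
      where
      R = third Q
      Q≁R : ¬ Q ∼ R
      Q≁R Q∼R = third≁Q Q∈S P≁Q β≉0 (∼-sym Q∼R)
      P∼-αQ+R : P ∼ lin (- α Q) Q 1# R
      P∼-αQ+R = ∼-intro P≉0 λ i → μx≈y⇒x≈μ⁻¹y (-x≉0 β≉0) (begin
        - β Q * P i                                   ≈⟨ solve 4 (λ a b p x → (:- b) :* p :=
                                                            (:- a) :* x :+ ((:- b) :* p :+ a :* x)) refl
                                                            (α Q) (β Q) (P i) (Q i) ⟩
        - α Q * Q i + R i                             ≈⟨ +-congˡ (*-identityˡ _) ⟨
        - α Q * Q i + 1# * R i                        ∎)
      QR⊄S : ¬ LineInS F Q R
      QR⊄S QR⊆S =
        P∉T (T-lines Q R Q∈S (third∈S Q∈S P≁Q α≉0) Q≁R QR⊆S P (P≉0 , - α Q , 1# , P∼-αQ+R))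
      3Q≈0 : eval F Q + (eval F Q + eval F Q) ≈ 0#
      3Q≈0 = trans (+-cong (proj₂ Q∈S) (+-cong (proj₂ Q∈S) (proj₂ Q∈S)))
                   (trans (+-identityˡ _) (+-identityˡ _))
      coefficients : ∀ n → restrict F Q R n ≈ vec4 0# (- (β Q * β Q) * 1#) (- (- (β Q * β Q) * - α Q)) 0# n
      coefficients zero                   = proj₂ Q∈S
      coefficients (suc zero)             = begin
        restrict F Q R (# 1)                          ≈⟨ restrict-shift₁ F (- β Q) P (α Q) Q ⟩
        - β Q * β Q + (α Q * eval F Q + (α Q * eval F Q + α Q * eval F Q))
          ≈⟨ +-congˡ (trans (sym (trans (distribˡ _ _ _) (+-congˡ (distribˡ _ _ _))))
                            (trans (*-congˡ 3Q≈0) (zeroʳ _))) ⟩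
        - β Q * β Q + 0#                              ≈⟨ +-identityʳ _ ⟩
        - β Q * β Q                                   ≈⟨ -‿distribˡ-* _ _ ⟨
        - (β Q * β Q)                                 ≈⟨ *-identityʳ _ ⟨
        - (β Q * β Q) * 1#                            ∎
      coefficients (suc (suc zero))       = begin
        restrict F Q R (# 2)                          ≈⟨ restrict-shift₂ F (- β Q) P (α Q) Q ⟩
        (- β Q * - β Q) * α Q + ((- β Q * α Q) * β Q + ((- β Q * α Q) * β Q +
          (α Q * α Q) * (eval F Q + (eval F Q + eval F Q))))
          ≈⟨ solve 3 (λ a b e → ((:- b) :* (:- b)) :* a :+ (((:- b) :* a) :* b :+ (((:- b) :* a) :* b :+
               (a :* a) :* e)) := :- ((:- (b :* b)) :* (:- a)) :+ (a :* a) :* e) refl (α Q) (β Q) _ ⟩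
        - (- (β Q * β Q) * - α Q) + (α Q * α Q) * (eval F Q + (eval F Q + eval F Q))
          ≈⟨ +-congˡ (trans (*-congˡ 3Q≈0) (zeroʳ _)) ⟩
        - (- (β Q * β Q) * - α Q) + 0#                ≈⟨ +-identityʳ _ ⟩
        - (- (β Q * β Q) * - α Q)                     ∎
      coefficients (suc (suc (suc zero))) = proj₂ (third∈S Q∈S P≁Q α≉0)

    Escaping : Vec4 → Set (c ⊔ ℓ)
    Escaping Q = ¬ α Q ≈ 0# × ¬ β Q ≈ 0# × ¬ third Q ∈ₚ T

    Unproductive : Vec4 → Set (c ⊔ ℓ)
    Unproductive Q = α Q ≈ 0# ⊎ Escaping Q

    span-or-unproductive : ∀ {Q} → Q ∈ₚ T → OnS F Q → InSpan F T P ⊎ Unproductive Q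
    span-or-unproductive {Q} Q∈T Q∈S with α Q ≟ 0# | β Q ≟ 0# | third Q ∈ₚ? T
    ... | yes α≈0 | _       | _        = inj₂ (inj₁ α≈0)
    ... | no α≉0  | yes β≈0 | _        = inj₁ (P-by-tangent Q∈T Q∈S (≁-of-∈T Q∈T) α≉0 β≈0)
    ... | no α≉0  | no β≉0  | yes R∈T  = inj₁ (P-by-secant Q∈T Q∈S (≁-of-∈T Q∈T) α≉0 β≉0 R∈T)
    ... | no α≉0  | no β≉0  | no R∉T   = inj₂ (inj₂ (α≉0 , β≉0 , R∉T))

    span-or-all-unproductive : All (OnS F) T → InSpan F T P ⊎ All Unproductive T
    span-or-all-unproductive T⊆S =
      All⊎⇒⊎All (All.zipWith (λ (Q∈S , Q∈T) → span-or-unproductive Q∈T Q∈S)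
                             (T⊆S , All.tabulateₛ ℙ³ id))

    points-on-PQ : ∀ {Q X x y} → OnS F Q → ¬ P ∼ Q → OnS F X → (∀ i → X i ≈ x * P i + y * Q i) →
                   X ∼ P ⊎ X ∼ Q ⊎ (¬ α Q ≈ 0# × X ∼ third Q)
    points-on-PQ {Q} {X} {x} {y} Q∈S P≁Q X∈S X≈xP+yQ = case x*y≈0⇒x≈0⊎y≈0 xy[xα+yβ]≈0 of λ
      { (inj₁ xy≈0)     → case x*y≈0⇒x≈0⊎y≈0 xy≈0 of λ
          { (inj₁ x≈0) → inj₂ (inj₁ (X∼Q x≈0))
          ; (inj₂ y≈0) → inj₁ (X∼P y≈0)
          }
      ; (inj₂ xα+yβ≈0) → case α Q ≟ 0# of λ
          { (yes α≈0)  → inj₁ (X∼P (y≈0 α≈0 xα+yβ≈0))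
          ; (no α≉0)   → inj₂ (inj₂ (α≉0 , X∼third α≉0 xα+yβ≈0))
          }
      }
      where
      xy[xα+yβ]≈0 : (x * y) * (x * α Q + y * β Q) ≈ 0#
      xy[xα+yβ]≈0 = begin
        (x * y) * (x * α Q + y * β Q)              ≈⟨ factor x y (α Q) (β Q) ⟩
        (x * x * y) * α Q + (x * y * y) * β Q      ≈⟨ eval-PQ Q∈S x y ⟨
        eval F (lin x P y Q)                       ≈⟨ eval-cong F X≈xP+yQ ⟨
        eval F X                                   ≈⟨ proj₂ X∈S ⟩
        0#                                         ∎
        where
        factor : ∀ x y a b → (x * y) * (x * a + y * b) ≈ (x * x * y) * a + (x * y * y) * b
        factor = solve 4 (λ x y a b → (x :* y) :* (x :* a :+ y :* b) :=
                                      (x :* x :* y) :* a :+ (x :* y :* y) :* b) refl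
      X∼P : y ≈ 0# → X ∼ P
      X∼P y≈0 = ∼-intro (proj₁ X∈S) λ i → begin
        X i                 ≈⟨ X≈xP+yQ i ⟩
        x * P i + y * Q i   ≈⟨ +-congˡ (trans (*-congʳ y≈0) (zeroˡ _)) ⟩
        x * P i + 0#        ≈⟨ +-identityʳ _ ⟩
        x * P i             ∎
      X∼Q : x ≈ 0# → X ∼ Q
      X∼Q x≈0 = ∼-intro (proj₁ X∈S) λ i → begin
        X i                 ≈⟨ X≈xP+yQ i ⟩
        x * P i + y * Q i   ≈⟨ +-congʳ (trans (*-congʳ x≈0) (zeroˡ _)) ⟩
        0# + y * Q i        ≈⟨ +-identityˡ _ ⟩
        y * Q i             ∎
      y≈0 : α Q ≈ 0# → x * α Q + y * β Q ≈ 0# → y ≈ 0#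
      y≈0 α≈0 xα+yβ≈0 = [ id , (λ β≈0 → ⊥-elim (¬α≈0∧β≈0 Q∈S P≁Q α≈0 β≈0)) ]′ (x*y≈0⇒x≈0⊎y≈0 (begin
        y * β Q                ≈⟨ +-identityˡ _ ⟨
        0# + y * β Q           ≈⟨ +-congʳ (trans (*-congˡ α≈0) (zeroʳ x)) ⟨
        x * α Q + y * β Q      ≈⟨ xα+yβ≈0 ⟩
        0#                     ∎))
      X∼third : (α≉0 : ¬ α Q ≈ 0#) → x * α Q + y * β Q ≈ 0# → X ∼ third Q
      X∼third α≉0 xα+yβ≈0 = ∼-intro (proj₁ X∈S) λ i → begin
        X i                                        ≈⟨ X≈xP+yQ i ⟩
        x * P i + y * Q i                          ≈⟨ +-congʳ (*-congʳ x≈-yβ/α) ⟩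
        (α⁻¹ * - (y * β Q)) * P i + y * Q i        ≈⟨ +-congˡ (*-congʳ (trans (sym (*-identityˡ y))
                                                        (*-congʳ (sym (*-inverseˡ (α Q) α≉0))))) ⟩
        (α⁻¹ * - (y * β Q)) * P i + ((α⁻¹ * α Q) * y) * Q i  ≈⟨ regroup α⁻¹ y (α Q) (β Q) (P i) (Q i) ⟩
        (y * α⁻¹) * third Q i                      ∎
        where
        α⁻¹ = inv (α Q) α≉0
        x≈-yβ/α : x ≈ α⁻¹ * - (y * β Q)
        x≈-yβ/α = μx≈y⇒x≈μ⁻¹y α≉0 (trans (*-comm _ _) (x+y≈0⇒y≈-x (trans (+-comm _ _) xα+yβ≈0)))
        regroup : ∀ ι y a b p x → (ι * - (y * b)) * p + ((ι * a) * y) * x ≈ (y * ι) * (- b * p + a * x)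
        regroup = solve 6 (λ ι y a b p x → (ι :* :- (y :* b)) :* p :+ ((ι :* a) :* y) :* x :=
                                           (y :* ι) :* ((:- b) :* p :+ a :* x)) refl

    third-injective : ∀ {Q Q′} → OnS F Q → ¬ P ∼ Q →
                      OnS F Q′ → ¬ P ∼ Q′ → ¬ α Q′ ≈ 0# → ¬ β Q′ ≈ 0# →
                      third Q′ ∼ third Q → Q′ ∼ Q
    third-injective {Q} {Q′} Q∈S P≁Q Q′∈S P≁Q′ α′≉0 β′≉0 R′∼R@(μ , _ , R′≈μR) =
      case points-on-PQ Q∈S P≁Q Q′∈S Q′≈xP+yQ of λ
        { (inj₁ Q′∼P)             → ⊥-elim (P≁Q′ (∼-sym Q′∼P))
        ; (inj₂ (inj₁ Q′∼Q))      → Q′∼Q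
        ; (inj₂ (inj₂ (_ , Q′∼R))) → ⊥-elim (third≁Q Q′∈S P≁Q′ β′≉0 (∼-trans R′∼R (∼-sym Q′∼R)))
        }
      where
      α′⁻¹ = inv (α Q′) α′≉0
      Q′≈xP+yQ : ∀ i → Q′ i ≈ (α′⁻¹ * (μ * - β Q + β Q′)) * P i + (α′⁻¹ * (μ * α Q)) * Q i
      Q′≈xP+yQ i = begin
        Q′ i                                                         ≈⟨ μx≈y⇒x≈μ⁻¹y α′≉0 (begin
          α Q′ * Q′ i                                                  ≈⟨ isolate (α Q′) (β Q′) (P i) (Q′ i) ⟩
          third Q′ i + β Q′ * P i                                      ≈⟨ +-congʳ (R′≈μR i) ⟩
          μ * third Q i + β Q′ * P i                                   ≈⟨ collect μ (β Q) (α Q) (β Q′) (P i) (Q i) ⟩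
          (μ * - β Q + β Q′) * P i + (μ * α Q) * Q i                   ∎) ⟩
        α′⁻¹ * ((μ * - β Q + β Q′) * P i + (μ * α Q) * Q i)           ≈⟨ distribute α′⁻¹ _ _ (P i) (Q i) ⟩
        (α′⁻¹ * (μ * - β Q + β Q′)) * P i + (α′⁻¹ * (μ * α Q)) * Q i  ∎
        where
        isolate : ∀ a b p x → a * x ≈ (- b * p + a * x) + b * p
        isolate = solve 4 (λ a b p x → a :* x := ((:- b) :* p :+ a :* x) :+ b :* p) refl
        collect : ∀ m b a b′ p x → m * (- b * p + a * x) + b′ * p ≈ (m * - b + b′) * p + (m * a) * x
        collect = solve 6 (λ m b a b′ p x → m :* ((:- b) :* p :+ a :* x) :+ b′ :* p :=
                                            (m :* (:- b) :+ b′) :* p :+ (m :* a) :* x) refl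
        distribute : ∀ ι c d p x → ι * (c * p + d * x) ≈ (ι * c) * p + (ι * d) * x
        distribute = solve 5 (λ ι c d p x → ι :* (c :* p :+ d :* x) := (ι :* c) :* p :+ (ι :* d) :* x) refl

    OnS∖P : Vec4 → Set (c ⊔ ℓ)
    OnS∖P Q = OnS F Q × ¬ P ∼ Q

    tangential? : U.Decidable (λ Q → α Q ≈ 0#)
    tangential? Q = α Q ≟ 0#

    tangential : List Vec4
    tangential = filter tangential? T

    transversal : List Vec4
    transversal = filter (∁? tangential?) T

    T⊆S∖P : All (OnS F) T → All OnS∖P T
    T⊆S∖P T⊆S = All.zip (T⊆S , ¬Any⇒All¬ T P∉T)

    module _ (T-distinct : Distinct T) (T⊆S : All (OnS F) T) (unproductive : All Unproductive T) where

      transversal-escaping : All (λ Q → OnS∖P Q × Escaping Q) transversal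
      transversal-escaping = All.zipWith escaping
        (filter⁺ (∁? tangential?) (All.zip (T⊆S∖P T⊆S , unproductive)) , all-filter (∁? tangential?) T)
        where
        escaping : ∀ {Q} → (OnS∖P Q × Unproductive Q) × ¬ α Q ≈ 0# → OnS∖P Q × Escaping Q
        escaping ((beyond , inj₁ α≈0) , α≉0) = ⊥-elim (α≉0 α≈0)
        escaping ((beyond , inj₂ esc) , _)   = beyond , esc

      P∷T++thirds : List Vec4
      P∷T++thirds = P ∷ T ++ map third transversal

      P∷T++thirds-distinct : Unique ℙ³ P∷T++thirds
      P∷T++thirds-distinct = ++⁺ (¬Any⇒All¬ T P∉T) (map⁺ (All.map P≁third transversal-escaping))
                      ∷ AllPairs.++⁺ T-distinct thirds-distinct (All.tabulateₛ ℙ³ T≁thirds)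
        where
        P≁third : ∀ {Q} → OnS∖P Q × Escaping Q → ¬ P ∼ third Q
        P≁third ((Q∈S , P≁Q) , α≉0 , _) P∼R = third≁P Q∈S P≁Q α≉0 (∼-sym P∼R)
        thirds-distinct : Unique ℙ³ (map third transversal)
        thirds-distinct = AllPairs.map⁺ (AllPairs-map-All
          (λ { ((Q∈S , P≁Q) , _) ((Q′∈S , P≁Q′) , α′≉0 , β′≉0 , _) Q≁Q′ R∼R′ →
               Q≁Q′ (∼-sym (third-injective Q∈S P≁Q Q′∈S P≁Q′ α′≉0 β′≉0 (∼-sym R∼R′))) })
          transversal-escaping (AllPairs.filter⁺ (∁? tangential?) T-distinct))
        T≁thirds : ∀ {t} → t ∈ₚ T → All (λ R → ¬ t ∼ R) (map third transversal)
        T≁thirds t∈T =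
          map⁺ (All.map (λ (_ , _ , _ , R∉T) t∼R → R∉T (∈-resp-≈ ℙ³ t∼R t∈T)) transversal-escaping)

      P∷T++thirds⊆S : All (OnS F) P∷T++thirds
      P∷T++thirds⊆S = P∈S ∷ ++⁺ T⊆S (map⁺ (All.map (λ ((Q∈S , P≁Q) , α≉0 , _) → third∈S Q∈S P≁Q α≉0)
                                                transversal-escaping))

      distinct-points-bound : ∀ {Ls} → EnumeratesS F Ls → ℕ.suc (length T ℕ.+ length transversal) ℕ.≤ length Ls
      distinct-points-bound {Ls} (_ , complete) = ℕ.≤-trans (ℕ.≤-reflexive (≡.cong ℕ.suc (≡.sym count)))
        (unique⇒length≤ ℙ³ P∷T++thirds-distinct (All.map (complete _) P∷T++thirds⊆S))
        where
        count : length (T ++ map third transversal) ≡ length T ℕ.+ length transversal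
        count = ≡.trans (length-++ T) (≡.cong (length T ℕ.+_) (length-map third transversal))

    module Tangential (smooth : Smooth F) where

      ∇P≉0 : NonZero (∇ F P)
      ∇P≉0 ∇P≈0 =
        smooth K id (isRingHomomorphism rawRing refl) P (proj₁ P∈S) (proj₂ P∈S , ∇P≈0)

      ∇P·P≈0 : dot (∇ F P) P ≈ 0#
      ∇P·P≈0 = trans (euler F P) (trans (+-cong (proj₂ P∈S) (+-cong (proj₂ P∈S) (proj₂ P∈S)))
                                        (trans (+-identityˡ _) (+-identityˡ _)))

      open Pencil (proj₁ P∈S) ∇P≉0 ∇P·P≈0

      tangential-in-plane : ∀ Q → α Q ≈ 0# → dot (∇ F P) Q ≈ 0#
      tangential-in-plane Q αQ≈0 = trans (sym (restrict₁-polar F P Q)) αQ≈0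

      pencil-separates : ∀ {Q Q′} → OnS∖P Q × α Q ≈ 0# → OnS∖P Q′ × α Q′ ≈ 0# →
                         ¬ Q ∼ Q′ → ¬ pencil Q ≡ pencil Q′
      pencil-separates {Q} {Q′} ((Q∈S , P≁Q) , αQ≈0) ((Q′∈S , P≁Q′) , αQ′≈0) Q≁Q′ same =
        case pencil-injective {Q′} {Q} (proj₁ Q′∈S) P≁Q′ (tangential-in-plane Q′ αQ′≈0)
                              (tangential-in-plane Q αQ≈0) same of λ
          { (_ , _ , Q≈aP+bQ′) → case points-on-PQ Q′∈S P≁Q′ Q∈S Q≈aP+bQ′ of λ
            { (inj₁ Q∼P)              → P≁Q (∼-sym Q∼P)
            ; (inj₂ (inj₁ Q∼Q′))      → Q≁Q′ Q∼Q′
            ; (inj₂ (inj₂ (α≉0 , _))) → α≉0 αQ′≈0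
            }
          }

      tangential-count : Distinct T → All (OnS F) T → length tangential ℕ.≤ ℕ.suc q
      tangential-count T-distinct T⊆S =
        ℕ.≤-trans (ℕ.≤-reflexive (≡.sym (length-map pencil tangential)))
          (ℕ.≤-trans (unique⇒length≤ (≡.setoid (Fin (ℕ.suc q))) pencils-distinct
                                      (All.tabulate (λ {i} _ → ∈-allFin i)))
                     (ℕ.≤-reflexive (length-tabulate id)))
        where
        tangential⊆S∖P : All (λ Q → OnS∖P Q × α Q ≈ 0#) tangential
        tangential⊆S∖P = All.zip (filter⁺ tangential? (T⊆S∖P T⊆S) , all-filter tangential? T)
        pencils-distinct : Unique (≡.setoid (Fin (ℕ.suc q))) (map pencil tangential)
        pencils-distinct = AllPairs.map⁺ {R = λ i j → ¬ i ≡ j} {f = pencil}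
          (AllPairs-map-All {P = λ Q → OnS∖P Q × α Q ≈ 0#} {R = λ Q Q′ → ¬ Q ∼ Q′}
                            {S = λ Q Q′ → ¬ pencil Q ≡ pencil Q′}
            pencil-separates tangential⊆S∖P (AllPairs.filter⁺ tangential? T-distinct))

2t≤L+q : ∀ {t a b L q} → t ≡ a ℕ.+ b → ℕ.suc (t ℕ.+ b) ℕ.≤ L → a ℕ.≤ ℕ.suc q →
         2 ℕ.* t ℕ.≤ L ℕ.+ q
2t≤L+q {t} {a} {b} {L} {q} t≡a+b t+b<L a≤1+q = ℕ.s≤s⁻¹ (begin
  ℕ.suc (2 ℕ.* t)          ≡⟨ ≡.cong ℕ.suc 2t≡t+b+a ⟩
  ℕ.suc (t ℕ.+ b) ℕ.+ a    ≤⟨ ℕ.+-mono-≤ t+b<L a≤1+q ⟩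
  L ℕ.+ ℕ.suc q            ≡⟨ ℕ.+-suc L q ⟩
  ℕ.suc (L ℕ.+ q)          ∎)
  where
  open ℕ.≤-Reasoning
  2t≡t+b+a : 2 ℕ.* t ≡ t ℕ.+ b ℕ.+ a
  2t≡t+b+a = ≡.trans (≡.cong (t ℕ.+_) (≡.trans (ℕ.+-identityʳ t) t≡a+b))
               (≡.trans (≡.cong (t ℕ.+_) (ℕ.+-comm a b)) (≡.sym (ℕ.+-assoc t b a)))

proposition3p2 : ∀ {c ℓ} (K : Field c ℓ) (q : ℕ) →
    Bijection (≡.setoid (Fin q)) (Field.setoid K) →
    let open Surface K in
    (F : Cubic) → Smooth F →
    (T : List Vec4) → IsSubsetOfS F T → ContainsKLines F T →
    (Ls : List Vec4) → EnumeratesS F Ls →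
    2 ℕ.* length T ℕ.> length Ls ℕ.+ (q ℕ.+ 1) →
    ∀ P → OnS F P → InSpan F T P
proposition3p2 K q enumeration F smooth T (T⊆S , T-distinct) T-lines Ls S-listed T-large P P∈S =
  case P ∈ₚ? T of λ
    { (yes P∈T) → base P∈T
    ; (no P∉T)  → generated-from-outside P∉T
    }
  where
  open Surface K
  open FiniteField K enumeration

  generated-from-outside : ¬ P ∈ₚ T → InSpan F T P
  generated-from-outside P∉T = [ id , ⊥-elim ∘ too-few ]′ (span-or-all-unproductive T⊆S)
    where
    open OutsidePoint F T T-lines P∈S P∉T
    too-few : All Unproductive T → ⊥
    too-few unproductive = ℕ.<⇒≱ T-large (ℕ.≤-trans
      (2t≤L+q (≡.sym (length-filter+filter∁ tangential? T))
              (distinct-points-bound T-distinct T⊆S unproductive S-listed)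
              (Tangential.tangential-count smooth T-distinct T⊆S))
      (ℕ.+-monoʳ-≤ (length Ls) (ℕ.m≤m+n q 1)))
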